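{- Let $q\ge2$, $m\ge0$ and $h=\frac{q^m-1}{q-1}$. The number of distinct unordered partitions of ${\bf Z}_q^{h}$ into subcubes that are defined by fractal matrices with parameters $q$ and $m$ (i.e. by matrices obtained from $M_{q,m}$ by permuting rows and columns) is exactly $h!$.
   Context: $M_{q,0}$ is the $1\times 0$ matrix; for $m\ge1$, $M_{q,m}$ is the matrix over ${\bf Z}_q\cup\{*\}$ whose rows are split into $q$ consecutive blocks $B_0,\dots,B_{q-1}$, each with as many rows as $M_{q,m-1}$; its first column equals $a$ on every row of $B_a$; its remaining columns are split into $q$ consecutive groups $G_0,\dots,G_{q-1}$, each with as many columns as $M_{q,m-1}$; the submatrix on $B_a\times G_a$ is $M_{q,m-1}$ and on $B_a\times G_b$, $b\ne a$, consists only of $*$. $M_{q,m}$ has $q^m$ rows and $h$ columns. A row $(x_1,\dots,x_h)\in({\bf Z}_q\cup\{*\})^h$ defines the subcube $\{v\in{\bf Z}_q^h: v_i=x_i \text{ whenever } x_i\in{\bf Z}_q\}$; a matrix defines the partition consisting of the subcubes of its rows. -}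

module Defs where

open import Data.Nat using (ℕ; zero; suc; _*_; _^_)
open import Data.Fin using (Fin; zero; suc; remQuot; _≟_)
open import Data.Fin.Permutation using (Permutation′; _⟨$⟩ʳ_)
open import Data.Maybe using (Maybe; just; nothing)
open import Data.Product using (_×_; _,_; ∃)
open import Relation.Nullary using (yes; no)
open import Relation.Binary.PropositionalEquality using (_≡_)

-- Entries of a fractal matrix: elements of Z_q (Fin q) or * (nothing).
Entry : ℕ → Set
Entry q = Maybe (Fin q)

-- Number of columns h of M_{q,m}: h(0) = 0, h(m+1) = 1 + q h(m)
-- (so h = (q^m - 1)/(q - 1) for q ≥ 2).
hcols : ℕ → ℕ → ℕ
hcols q zero    = zero
hcols q (suc m) = suc (q * hcols q m)

Matrix : ℕ → ℕ → ℕ → Set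
Matrix q r c = Fin r → Fin c → Entry q

-- Rows of M_{q,m+1}: Fin (q * q^m), split by remQuot into (block a, row r of M_{q,m});
-- columns: the first column, then Fin (q * h) split into (group b, column c of M_{q,m}).
M : (q m : ℕ) → Matrix q (q ^ m) (hcols q m)
M q zero    i ()
M q (suc m) i zero    with remQuot {q} (q ^ m) i
... | a , r = just a
M q (suc m) i (suc j) with remQuot {q} (q ^ m) i | remQuot {q} (hcols q m) j
... | a , r | b , c with a ≟ b
...   | yes _ = M q m r c
...   | no  _ = nothing

Subcube : {q h : ℕ} → (Fin h → Entry q) → (Fin h → Fin q) → Set
Subcube {q} {h} x v = ∀ (j : Fin h) (c : Fin q) → x j ≡ just c → v j ≡ c

SameSubset : {q h : ℕ} → ((Fin h → Fin q) → Set) → ((Fin h → Fin q) → Set) → Set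
SameSubset {q} {h} A B = ∀ (v : Fin h → Fin q) → (A v → B v) × (B v → A v)

SamePartition : {q r s h : ℕ} → Matrix q r h → Matrix q s h → Set
SamePartition {q} {r} {s} {h} A B =
  (∀ (i : Fin r) → ∃ λ (k : Fin s) → SameSubset (Subcube (A i)) (Subcube (B k)))
  × (∀ (k : Fin s) → ∃ λ (i : Fin r) → SameSubset (Subcube (B k)) (Subcube (A i)))

FractalData : ℕ → ℕ → Set
FractalData q m = Permutation′ (q ^ m) × Permutation′ (hcols q m)

fractal : (q m : ℕ) → FractalData q m → Matrix q (q ^ m) (hcols q m)
fractal q m (ρ , σ) i j = M q m (ρ ⟨$⟩ʳ i) (σ ⟨$⟩ʳ j)

{-# OPTIONS --safe #-}
-- A partition determines its rows: for q ≥ 2 a subcube determines the row defining it.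
-- Permuting rows does not change the partition, so it suffices to show that distinct
-- column permutations of M_{q,m} give distinct row sets, i.e. that a column map π
-- sending every row of M_{q,m} to a row is the identity. The first column is the only
-- one without *, so π fixes it and every row is sent to a row of the same block. The *
-- pattern then forces π to map each group G_b into itself, and on B_b × G_b it induces
-- a row-preserving map of M_{q,m-1}, which is the identity by induction.
module Submission where

open import Defs
open import Data.Nat using (ℕ; _≤_; _!)
open import Data.Fin using (Fin)
open import Data.Product using (_×_; ∃)
open import Relation.Binary.PropositionalEquality using (_≡_)

open import Data.Nat using (zero; suc; _*_; _^_; s≤s)
open import Data.Fin using (zero; suc; combine; remQuot; quotient; remainder; punchIn; _≟_; fromℕ<)
open import Data.Fin.Properties using (remQuot-combine; combine-surjective; punchIn-injective)
open import Data.Fin.Permutation as Perm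
  using (Permutation; Permutation′; _⟨$⟩ʳ_; _⟨$⟩ˡ_; _≈_; insert; remove; inverseˡ; inverseʳ; insert-punchIn; insert-remove)
open import Data.Maybe using (Maybe; just; nothing; fromMaybe)
open import Data.Maybe.Properties using (just-injective)
open import Data.Product using (_,_; proj₁; proj₂; ∃₂)
open import Function using (_∘′_)
open import Relation.Nullary using (yes; no; contradiction)
open import Relation.Binary.PropositionalEquality
  using (_≢_; _≗_; refl; sym; trans; cong; module ≡-Reasoning)

open ≡-Reasoning

enumerate : ∀ n → Fin (n !) → Permutation′ n
enumerate zero    _ = Perm.id
enumerate (suc n) i = insert zero (quotient {suc n} (n !) i) (enumerate n (remainder {suc n} (n !) i))

enumerate-combine : ∀ n (a : Fin (suc n)) (i : Fin (n !)) →
                    enumerate (suc n) (combine a i) ≈ insert zero a (enumerate n i)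
enumerate-combine n a i j =
  cong (λ (b , k) → insert zero b (enumerate n k) ⟨$⟩ʳ j) (remQuot-combine {suc n} {n !} a i)

insert-cong : ∀ {n} (a : Fin (suc n)) {τ τ′ : Permutation′ n} →
              τ ≈ τ′ → insert zero a τ ≈ insert zero a τ′
insert-cong a         τ≈τ′ zero    = refl
insert-cong a {τ} {τ′} τ≈τ′ (suc j) = begin
  insert zero a τ ⟨$⟩ʳ suc j   ≡⟨ insert-punchIn zero a τ j ⟩
  punchIn a (τ ⟨$⟩ʳ j)         ≡⟨ cong (punchIn a) (τ≈τ′ j) ⟩
  punchIn a (τ′ ⟨$⟩ʳ j)        ≡⟨ insert-punchIn zero a τ′ j ⟨
  insert zero a τ′ ⟨$⟩ʳ suc j  ∎

insert-injective : ∀ {n} {a b : Fin (suc n)} {τ τ′ : Permutation′ n} →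
                   insert zero a τ ≈ insert zero b τ′ → a ≡ b × τ ≈ τ′
insert-injective {a = a} {τ = τ} {τ′} eq with refl ← eq zero = refl , λ j →
  punchIn-injective a _ _ (begin
    punchIn a (τ ⟨$⟩ʳ j)         ≡⟨ insert-punchIn zero a τ j ⟨
    insert zero a τ ⟨$⟩ʳ suc j   ≡⟨ eq (suc j) ⟩
    insert zero a τ′ ⟨$⟩ʳ suc j  ≡⟨ insert-punchIn zero a τ′ j ⟩
    punchIn a (τ′ ⟨$⟩ʳ j)        ∎)

enumerate-injective : ∀ n {i k} → enumerate n i ≈ enumerate n k → i ≡ k
enumerate-injective zero    {zero} {zero} _ = refl
enumerate-injective (suc n) {i} {k} eq
  with a , i′ , refl ← combine-surjective {suc n} {n !} i
     | b , k′ , refl ← combine-surjective {suc n} {n !} k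
  with refl , τ≈τ′ ← insert-injective {a = a} {b} (λ j →
         trans (sym (enumerate-combine n a i′ j)) (trans (eq j) (enumerate-combine n b k′ j)))
  = cong (combine a) (enumerate-injective n τ≈τ′)

enumerate-surjective : ∀ n (σ : Permutation′ n) → ∃ λ i → enumerate n i ≈ σ
enumerate-surjective zero    σ = zero , λ ()
enumerate-surjective (suc n) σ with enumerate-surjective n (remove zero σ)
... | i , i≈σ′ = combine a i , λ j → begin
  enumerate (suc n) (combine a i) ⟨$⟩ʳ j  ≡⟨ enumerate-combine n a i j ⟩
  insert zero a (enumerate n i) ⟨$⟩ʳ j    ≡⟨ insert-cong a i≈σ′ j ⟩
  insert zero a (remove zero σ) ⟨$⟩ʳ j    ≡⟨ insert-remove zero σ j ⟩
  σ ⟨$⟩ʳ j                                ∎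
  where a = σ ⟨$⟩ʳ zero

another : ∀ {q} → 2 ≤ q → Fin q → Fin q
another (s≤s (s≤s _)) zero    = suc zero
another (s≤s (s≤s _)) (suc _) = zero

another-≢ : ∀ {q} (2≤q : 2 ≤ q) (a : Fin q) → another 2≤q a ≢ a
another-≢ (s≤s (s≤s _)) zero    ()
another-≢ (s≤s (s≤s _)) (suc _) ()

fromMaybe-≢ : ∀ {A : Set} {d c : A} {e : Maybe A} → d ≢ c → fromMaybe d e ≡ c → e ≡ just c
fromMaybe-≢ {e = just _}  _   refl = refl
fromMaybe-≢ {e = nothing} d≢c d≡c  = contradiction d≡c d≢c

≡-by-just : ∀ {A : Set} {a b : Maybe A} →
            (∀ {c} → a ≡ just c → b ≡ just c) → (∀ {c} → b ≡ just c → a ≡ just c) → a ≡ b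
≡-by-just {a = just c}                 a⇒b _   = sym (a⇒b refl)
≡-by-just {a = nothing} {b = just c}   _   b⇒a = b⇒a refl
≡-by-just {a = nothing} {b = nothing}  _   _   = refl

module _ {q h : ℕ} where

  complete : (Fin h → Entry q) → (Fin h → Fin q) → Fin h → Fin q
  complete x v j = fromMaybe (v j) (x j)

  complete-∈ : ∀ x v → Subcube x (complete x v)
  complete-∈ x v j c xj≡c = cong (fromMaybe (v j)) xj≡c

  ≗⇒SameSubset : ∀ {x y : Fin h → Entry q} → x ≗ y → SameSubset (Subcube x) (Subcube y)
  ≗⇒SameSubset x≗y v = (λ x∋v j c yj≡c → x∋v j c (trans (x≗y j) yj≡c))
                     , (λ y∋v j c xj≡c → y∋v j c (trans (sym (x≗y j)) xj≡c))

  Subcube-⊆⇒fixed : 2 ≤ q → ∀ {x y : Fin h → Entry q} → (∀ v → Subcube y v → Subcube x v) →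
                    ∀ {j c} → x j ≡ just c → y j ≡ just c
  Subcube-⊆⇒fixed 2≤q {x} {y} y⊆x {j} {c} xj≡c =
    fromMaybe-≢ (another-≢ 2≤q c) (y⊆x (complete y v) (complete-∈ y v) j c xj≡c)
    where v = λ _ → another 2≤q c

  Subcube-injective : 2 ≤ q → ∀ {x y : Fin h → Entry q} → SameSubset (Subcube x) (Subcube y) → x ≗ y
  Subcube-injective 2≤q same j = ≡-by-just (Subcube-⊆⇒fixed 2≤q (λ v → proj₂ (same v)))
                                          (Subcube-⊆⇒fixed 2≤q (λ v → proj₁ (same v)))

  module _ {r s : ℕ} {A : Matrix q r h} {B : Matrix q s h} where

    SamePartition⇒rows⊆ : 2 ≤ q → SamePartition A B → ∀ i → ∃ λ k → A i ≗ B k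
    SamePartition⇒rows⊆ 2≤q (A⊆B , _) i with k , same ← A⊆B i = k , Subcube-injective 2≤q same

    reindex⇒SamePartition : (ρ : Permutation r s) → (∀ i → A i ≗ B (ρ ⟨$⟩ʳ i)) → SamePartition A B
    reindex⇒SamePartition ρ A≗Bρ =
      (λ i → ρ ⟨$⟩ʳ i , ≗⇒SameSubset (A≗Bρ i)) ,
      (λ k → ρ ⟨$⟩ˡ k , ≗⇒SameSubset λ j →
        trans (cong (λ i → B i j) (sym (inverseʳ ρ))) (sym (A≗Bρ (ρ ⟨$⟩ˡ k) j)))

quotient-combine : ∀ {m n} (a : Fin m) (s : Fin n) → quotient {m} n (combine a s) ≡ a
quotient-combine {m} {n} a s = cong proj₁ (remQuot-combine {m} {n} a s)

remainder-combine : ∀ {m n} (a : Fin m) (s : Fin n) → remainder {m} n (combine a s) ≡ s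
remainder-combine {m} {n} a s = cong proj₂ (remQuot-combine {m} {n} a s)

block : ∀ {q} m → Fin (q ^ suc m) → Fin q
block {q} m = quotient {q} (q ^ m)

group : ∀ {q} m → Fin (q * hcols q m) → Fin q
group {q} m = quotient {q} (hcols q m)

module _ {q m : ℕ} where

  M-onBlock : ∀ {i j} → block m i ≡ group m j →
            M q (suc m) i (suc j) ≡ M q m (remainder {q} (q ^ m) i) (remainder {q} (hcols q m) j)
  M-onBlock {i} {j} i≡j with proj₁ (remQuot {q} (q ^ m) i) ≟ proj₁ (remQuot {q} (hcols q m) j)
  ... | yes _   = refl
  ... | no  i≢j = contradiction i≡j i≢j

  M-offBlock : ∀ {i j} → block m i ≢ group m j → M q (suc m) i (suc j) ≡ nothing
  M-offBlock {i} {j} i≢j with proj₁ (remQuot {q} (q ^ m) i) ≟ proj₁ (remQuot {q} (hcols q m) j)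
  ... | yes i≡j = contradiction i≡j i≢j
  ... | no  _   = refl

  M-combine : ∀ a s c → M q (suc m) (combine a s) (suc (combine a c)) ≡ M q m s c
  M-combine a s c = begin
    M q (suc m) (combine a s) (suc (combine a c))
      ≡⟨ M-onBlock (trans (quotient-combine a s) (sym (quotient-combine a c))) ⟩
    M q m (remainder {q} (q ^ m) (combine a s)) (remainder {q} (hcols q m) (combine a c))
      ≡⟨ cong (λ s′ → M q m s′ _) (remainder-combine a s) ⟩
    M q m s (remainder {q} (hcols q m) (combine a c))
      ≡⟨ cong (M q m s) (remainder-combine a c) ⟩
    M q m s c ∎

PreservesRows : ∀ q m → (Fin (hcols q m) → Fin (hcols q m)) → Set
PreservesRows q m π = ∀ r′ → ∃ λ r → (λ j → M q m r′ (π j)) ≗ M q m r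

module Rigidity {q : ℕ} (2≤q : 2 ≤ q) where

  someRow : ∀ m → Fin (q ^ m)
  someRow zero    = zero
  someRow (suc m) = combine (fromℕ< 2≤q) (someRow m)

  column-has-entry : ∀ m (c : Fin (hcols q m)) → ∃₂ λ r a → M q m r c ≡ just a
  column-has-entry (suc m) zero = someRow (suc m) , _ , refl
  column-has-entry (suc m) (suc j) with b , c , refl ← combine-surjective {q} {hcols q m} j
                                   with r , a , r∋a ← column-has-entry m c
    = combine b r , a , trans (M-combine b r c) r∋a

  module InductiveStep (m : ℕ) (π : Fin (hcols q (suc m)) → Fin (hcols q (suc m)))
              (preserves : PreservesRows q (suc m) π) where

    match : Fin (q ^ suc m) → Fin (q ^ suc m)
    match r′ = proj₁ (preserves r′)

    match-entry : ∀ r′ j → M q (suc m) r′ (π j) ≡ M q (suc m) (match r′) j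
    match-entry r′ = proj₂ (preserves r′)

    rowOutside : Fin q → Fin (q ^ suc m)
    rowOutside b = combine (another 2≤q b) (someRow m)

    rowOutside-≢ : ∀ b → block m (rowOutside b) ≢ b
    rowOutside-≢ b eq = another-≢ 2≤q b (trans (sym (quotient-combine (another 2≤q b) (someRow m))) eq)

    π-zero : π zero ≡ zero
    π-zero with π zero in eq
    ... | zero  = refl
    ... | suc j = contradiction (begin
      nothing                                         ≡⟨ M-offBlock (rowOutside-≢ (group m j)) ⟨
      M q (suc m) (rowOutside (group m j)) (suc j)    ≡⟨ cong (M q (suc m) _) eq ⟨
      M q (suc m) (rowOutside (group m j)) (π zero)   ≡⟨ match-entry _ zero ⟩
      just (block m (match (rowOutside (group m j)))) ∎) λ ()

    match-block : ∀ r′ → block m (match r′) ≡ block m r′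
    match-block r′ = sym (just-injective (begin
      just (block m r′)          ≡⟨ cong (M q (suc m) r′) π-zero ⟨
      M q (suc m) r′ (π zero)    ≡⟨ match-entry r′ zero ⟩
      just (block m (match r′))  ∎))

    offBlock-starred : ∀ {r′ b c} → block m r′ ≢ b → M q (suc m) r′ (π (suc (combine b c))) ≡ nothing
    offBlock-starred {r′} {b} {c} r′∉b = trans (match-entry r′ _) (M-offBlock λ r∈b →
      r′∉b (trans (sym (match-block r′)) (trans r∈b (quotient-combine b c))))

    π-within-group : ∀ b c → ∃ λ c′ → π (suc (combine b c)) ≡ suc (combine b c′)
    π-within-group b c with π (suc (combine b c)) in eq
    ... | zero = contradiction
      (trans (cong (M q (suc m) (rowOutside b)) (sym eq)) (offBlock-starred (rowOutside-≢ b))) λ ()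
    ... | suc j′ with b′ , c′ , refl ← combine-surjective {q} {hcols q m} j′ with b′ ≟ b
    ...   | yes refl = c′ , eq
    ...   | no b′≢b with r , a , r∋a ← column-has-entry m c′ = contradiction (begin
      just a                                              ≡⟨ r∋a ⟨
      M q m r c′                                          ≡⟨ M-combine b′ r c′ ⟨
      M q (suc m) (combine b′ r) (suc (combine b′ c′))    ≡⟨ cong (M q (suc m) _) eq ⟨
      M q (suc m) (combine b′ r) (π (suc (combine b c)))  ≡⟨ offBlock-starred (b′≢b ∘′ trans (sym (quotient-combine b′ r))) ⟩
      nothing                                             ∎) λ ()

    πᵇ : Fin q → Fin (hcols q m) → Fin (hcols q m)
    πᵇ b c = proj₁ (π-within-group b c)

    πᵇ-preserves : ∀ b → PreservesRows q m (πᵇ b)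
    πᵇ-preserves b s′ = remainder {q} (q ^ m) r , λ c → begin
      M q m s′ (πᵇ b c)                                   ≡⟨ M-combine b s′ (πᵇ b c) ⟨
      M q (suc m) r′ (suc (combine b (πᵇ b c)))           ≡⟨ cong (M q (suc m) r′) (proj₂ (π-within-group b c)) ⟨
      M q (suc m) r′ (π (suc (combine b c)))              ≡⟨ match-entry r′ _ ⟩
      M q (suc m) r (suc (combine b c))                   ≡⟨ M-onBlock (trans r∈b (sym (quotient-combine b c))) ⟩
      M q m (remainder {q} (q ^ m) r) (remainder {q} (hcols q m) (combine b c))
                                                          ≡⟨ cong (M q m _) (remainder-combine b c) ⟩
      M q m (remainder {q} (q ^ m) r) c                   ∎
      where
      r′ = combine b s′
      r  = match r′
      r∈b : block m r ≡ b
      r∈b = trans (match-block r′) (quotient-combine b s′)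

    fixed-if-πᵇ-fixed : (∀ b c → πᵇ b c ≡ c) → ∀ j → π j ≡ j
    fixed-if-πᵇ-fixed _     zero    = π-zero
    fixed-if-πᵇ-fixed fixed (suc j) with b , c , refl ← combine-surjective {q} {hcols q m} j =
      trans (proj₂ (π-within-group b c)) (cong (λ c′ → suc (combine b c′)) (fixed b c))

  preservesRows⇒≗id : ∀ m {π} → PreservesRows q m π → ∀ j → π j ≡ j
  preservesRows⇒≗id (suc m) {π} preserves =
    fixed-if-πᵇ-fixed λ b → preservesRows⇒≗id m (πᵇ-preserves b)
    where open InductiveStep m π preserves

  columns-rigid : ∀ m (σ τ : Permutation′ (hcols q m)) →
                  (∀ r → ∃ λ k → (λ j → M q m r (σ ⟨$⟩ʳ j)) ≗ (λ j → M q m k (τ ⟨$⟩ʳ j))) →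
                  σ ≈ τ
  columns-rigid m σ τ rows⊆ j = begin
    σ ⟨$⟩ʳ j                   ≡⟨ cong (σ ⟨$⟩ʳ_) (inverseˡ τ) ⟨
    σ ⟨$⟩ʳ (τ ⟨$⟩ˡ (τ ⟨$⟩ʳ j))  ≡⟨ preservesRows⇒≗id m π-preserves (τ ⟨$⟩ʳ j) ⟩
    τ ⟨$⟩ʳ j                   ∎
    where
    π-preserves : PreservesRows q m (λ j → σ ⟨$⟩ʳ (τ ⟨$⟩ˡ j))
    π-preserves r with k , σr≗τk ← rows⊆ r = k , λ j →
      trans (σr≗τk (τ ⟨$⟩ˡ j)) (cong (M q m k) (inverseʳ τ))

mainTheorem14 : (q m : ℕ) → 2 ≤ q →
    ∃ λ (f : Fin (hcols q m !) → FractalData q m) →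
      (∀ (i k : Fin (hcols q m !)) →
         SamePartition (fractal q m (f i)) (fractal q m (f k)) → i ≡ k)
      × (∀ (d : FractalData q m) → ∃ λ (i : Fin (hcols q m !)) →
           SamePartition (fractal q m d) (fractal q m (f i)))
mainTheorem14 q m 2≤q = f , f-injective , f-surjective
  where
  f : Fin (hcols q m !) → FractalData q m
  f i = Perm.id , enumerate (hcols q m) i

  f-injective : ∀ i k → SamePartition (fractal q m (f i)) (fractal q m (f k)) → i ≡ k
  f-injective i k same = enumerate-injective (hcols q m)
    (Rigidity.columns-rigid 2≤q m (enumerate _ i) (enumerate _ k) (SamePartition⇒rows⊆ 2≤q same))

  f-surjective : ∀ d → ∃ λ i → SamePartition (fractal q m d) (fractal q m (f i))
  f-surjective (ρ , σ) with i , i≈σ ← enumerate-surjective (hcols q m) σ =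
    i , reindex⇒SamePartition ρ λ r j → cong (M q m (ρ ⟨$⟩ʳ r)) (sym (i≈σ j))
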